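{- Let $X,Y,Z$ be trees. If $X$ is open and at least one of $Y$ and $Z$ is open, then $X[\mathsf{T}\mapsto Y,\mathsf{F}\mapsto Z]$ is open.
   Context: Fix a set $\mathcal{A}$ of atoms. Trees: $X ::= \mathsf{T}\mid\mathsf{F}\mid X\trianglelefteq a\trianglerighteq X$ ($a\in\mathcal{A}$). Substitution: $\mathsf{T}[\mathsf{T}\mapsto Y,\mathsf{F}\mapsto Z]=Y$, $\mathsf{F}[\mathsf{T}\mapsto Y,\mathsf{F}\mapsto Z]=Z$, $(X_1\trianglelefteq a\trianglerighteq X_2)[\ldots]=X_1[\ldots]\trianglelefteq a\trianglerighteq X_2[\ldots]$. A tree is closed by $\mathsf{T}$ (resp. $\mathsf{F}$) if all its leaves are $\mathsf{T}$ (resp. $\mathsf{F}$); it is open if it is not closed (i.e. it has both a $\mathsf{T}$ leaf and an $\mathsf{F}$ leaf). -}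

module Defs where

open import Data.Product using (_×_)
open import Relation.Nullary using (¬_)

data Tree {a} (A : Set a) : Set a where
  T   : Tree A
  F   : Tree A
  _⊴_⊵_ : Tree A → A → Tree A → Tree A

module _ {a} {A : Set a} where

  _[T↦_,F↦_] : Tree A → Tree A → Tree A → Tree A
  T [T↦ Y ,F↦ Z ] = Y
  F [T↦ Y ,F↦ Z ] = Z
  (X₁ ⊴ x ⊵ X₂) [T↦ Y ,F↦ Z ] = (X₁ [T↦ Y ,F↦ Z ]) ⊴ x ⊵ (X₂ [T↦ Y ,F↦ Z ])

  data ClosedByT : Tree A → Set a where
    leafT : ClosedByT T
    node  : ∀ {X₁ X₂} x → ClosedByT X₁ → ClosedByT X₂ → ClosedByT (X₁ ⊴ x ⊵ X₂)

  data ClosedByF : Tree A → Set a where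
    leafF : ClosedByF F
    node  : ∀ {X₁ X₂} x → ClosedByF X₁ → ClosedByF X₂ → ClosedByF (X₁ ⊴ x ⊵ X₂)

  Open : Tree A → Set a
  Open X = ¬ ClosedByT X × ¬ ClosedByF X

module Submission where

-- An
-- open X has both a T-leaf and an F-leaf, so both Y and Z occur as subtrees
-- of X[T ↦ Y, F ↦ Z]; and a tree with an open subtree is open, because
-- closedness (by T or by F) is inherited by every subtree.

open import Defs
open import Data.Sum using (_⊎_; inj₁; inj₂; [_,_]; [_,_]′)
open import Data.Product using (_,_)
open import Function using (id)
open import Relation.Nullary using (¬_; contradiction)

module _ {a} {A : Set a} where

  data Subtree (S : Tree A) : Tree A → Set a where
    here  : Subtree S S
    left  : ∀ {X₁ X₂} x → Subtree S X₁ → Subtree S (X₁ ⊴ x ⊵ X₂)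
    right : ∀ {X₁ X₂} x → Subtree S X₂ → Subtree S (X₁ ⊴ x ⊵ X₂)

  subtree-closedByT : ∀ {S X} → Subtree S X → ClosedByT X → ClosedByT S
  subtree-closedByT here        c            = c
  subtree-closedByT (left _ s)  (node _ c _) = subtree-closedByT s c
  subtree-closedByT (right _ s) (node _ _ c) = subtree-closedByT s c

  subtree-closedByF : ∀ {S X} → Subtree S X → ClosedByF X → ClosedByF S
  subtree-closedByF here        c            = c
  subtree-closedByF (left _ s)  (node _ c _) = subtree-closedByF s c
  subtree-closedByF (right _ s) (node _ _ c) = subtree-closedByF s c

  open-subtree : ∀ {S X} → Subtree S X → Open S → Open X
  open-subtree s (¬cT , ¬cF) =
    (λ c → ¬cT (subtree-closedByT s c)) , (λ c → ¬cF (subtree-closedByF s c))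

  -- Applied to the
  -- leaves S = T and S = F this says that Y and Z occur in the substitution.
  subtree-subst : ∀ {S X} Y Z → Subtree S X →
                  Subtree (S [T↦ Y ,F↦ Z ]) (X [T↦ Y ,F↦ Z ])
  subtree-subst Y Z here        = here
  subtree-subst Y Z (left x s)  = left x (subtree-subst Y Z s)
  subtree-subst Y Z (right x s) = right x (subtree-subst Y Z s)

  -- Constructive dichotomies: a tree is closed by F or has a T-leaf, and
  -- symmetrically.  They turn "not closed" into an explicit leaf.
  closedByF-or-T-leaf : ∀ X → ClosedByF X ⊎ Subtree T X
  closedByF-or-T-leaf T = inj₂ here
  closedByF-or-T-leaf F = inj₁ leafF
  closedByF-or-T-leaf (X₁ ⊴ x ⊵ X₂)
    with closedByF-or-T-leaf X₁ | closedByF-or-T-leaf X₂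
  ... | inj₁ c₁ | inj₁ c₂ = inj₁ (node x c₁ c₂)
  ... | inj₂ t₁ | _       = inj₂ (left x t₁)
  ... | inj₁ _  | inj₂ t₂ = inj₂ (right x t₂)

  closedByT-or-F-leaf : ∀ X → ClosedByT X ⊎ Subtree F X
  closedByT-or-F-leaf T = inj₁ leafT
  closedByT-or-F-leaf F = inj₂ here
  closedByT-or-F-leaf (X₁ ⊴ x ⊵ X₂)
    with closedByT-or-F-leaf X₁ | closedByT-or-F-leaf X₂
  ... | inj₁ c₁ | inj₁ c₂ = inj₁ (node x c₁ c₂)
  ... | inj₂ f₁ | _       = inj₂ (left x f₁)
  ... | inj₁ _  | inj₂ f₂ = inj₂ (right x f₂)

  T-leaf : ∀ X → ¬ ClosedByF X → Subtree T X
  T-leaf X ¬cF = [ (λ c → contradiction c ¬cF) , id ]′ (closedByF-or-T-leaf X)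

  F-leaf : ∀ X → ¬ ClosedByT X → Subtree F X
  F-leaf X ¬cT = [ (λ c → contradiction c ¬cT) , id ]′ (closedByT-or-F-leaf X)

proposition2p10 : ∀ {a} {A : Set a} (X Y Z : Tree A) →
    Open X → Open Y ⊎ Open Z → Open (X [T↦ Y ,F↦ Z ])
proposition2p10 X Y Z (¬cT , ¬cF) =
  [ open-subtree Y-occurs , open-subtree Z-occurs ]
  where
    Y-occurs : Subtree Y (X [T↦ Y ,F↦ Z ])
    Y-occurs = subtree-subst Y Z (T-leaf X ¬cF)

    Z-occurs : Subtree Z (X [T↦ Y ,F↦ Z ])
    Z-occurs = subtree-subst Y Z (F-leaf X ¬cT)
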